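{- Let $D_1,D_2,D_3$ be three vertex disjoint digraphs with Hamiltonian cycles $C_1,C_2,C_3$, respectively, and let $D\in D_1\oplus D_2\oplus D_3$. If there is a permutation $(i_1,i_2,i_3)$ of $(1,2,3)$ such that $D_{i_1}\mapsto D_{i_2}$, $D_{i_2}\mapsto D_{i_3}$ and $D_{i_3}\mapsto D_{i_1}$ in $D$, then $D$ is vertex-pancyclic.
   Context: All cycles are directed. Generalized sum: for pairwise vertex disjoint digraphs $D_1,\ldots,D_k$, $\oplus_{i=1}^k D_i$ is the set of all digraphs $D$ with $V(D)=\bigcup_i V(D_i)$, such that the subdigraph of $D$ induced by $V(D_i)$ is $D_i$ for each $i$, and such that between each pair of vertices lying in different $D_i$'s there is exactly one arc (in one direction). For vertex sets (or subdigraphs) $A,B$, $A\mapsto B$ means that $a\to b$ is an arc for every $a\in A$, $b\in B$, and there is no arc from $B$ to $A$. A digraph $D$ of order $N\ge 3$ is vertex-pancyclic if for every vertex $v$ and every $\ell\in\{3,\ldots,N\}$, $D$ contains a directed cycle of length $\ell$ through $v$. -}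

module Defs where

open import Data.Nat using (ℕ; zero; suc; _≤_)
open import Data.Fin using (Fin; zero; suc; inject₁; fromℕ)
open import Data.Product using (Σ; ∃; _×_)
open import Data.Sum using (_⊎_)
open import Relation.Nullary using (¬_)
open import Relation.Binary.PropositionalEquality using (_≡_; _≢_)
open import Function.Definitions using (Injective)

ArcRel : ℕ → Set₁
ArcRel N = Fin N → Fin N → Set

-- Digraphs have no loops (and no parallel arcs, automatic for a relation).
Loopless : {N : ℕ} → ArcRel N → Set
Loopless {N} A = ∀ (v : Fin N) → ¬ A v v

IsCycle : {N m : ℕ} → ArcRel N → (Fin (suc m) → Fin N) → Set
IsCycle {N} {m} A c =
  Injective _≡_ _≡_ c
  × (∀ (j : Fin m) → A (c (inject₁ j)) (c (suc j)))
  × A (c (fromℕ m)) (c zero)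

HasCycleThrough : {N : ℕ} → ArcRel N → Fin N → ℕ → Set
HasCycleThrough A v zero = Data.Empty.⊥
  where import Data.Empty
HasCycleThrough A v (suc m) =
  Σ (Fin (suc m) → _) λ c → IsCycle A c × ∃ λ j → c j ≡ v

VertexPancyclic : (N : ℕ) → ArcRel N → Set
VertexPancyclic N A =
  3 ≤ N × (∀ (v : Fin N) (ℓ : ℕ) → 3 ≤ ℓ → ℓ ≤ N → HasCycleThrough A v ℓ)

PartHamiltonian : {N : ℕ} → ArcRel N → (Fin N → Fin 3) → Fin 3 → Set
PartHamiltonian {N} A part i =
  Σ ℕ λ m → 1 ≤ m × Σ (Fin (suc m) → Fin N) λ c →
    IsCycle A c
    × (∀ j → part (c j) ≡ i)
    × (∀ v → part v ≡ i → ∃ λ j → c j ≡ v)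

GenSumCond : {N : ℕ} → ArcRel N → (Fin N → Fin 3) → Set
GenSumCond {N} A part =
  ∀ (u v : Fin N) → part u ≢ part v → (A u v ⊎ A v u) × ¬ (A u v × A v u)

MapsTo : {N : ℕ} → ArcRel N → (Fin N → Fin 3) → Fin 3 → Fin 3 → Set
MapsTo {N} A part i j =
  ∀ (a b : Fin N) → part a ≡ i → part b ≡ j → A a b × ¬ A b a

-- Write the parts in their cyclic order p ↦ q ↦ r ↦ p and let v lie in D_p.
-- Split ℓ = a + b + c with 1 ≤ a ≤ |D_p|, 1 ≤ b ≤ |D_q|, 1 ≤ c ≤ |D_r|.
-- Along the Hamiltonian cycle of D_p take a path of a vertices containing v,
-- and along those of D_q and D_r paths of b and c vertices.  Since every
-- vertex of D_p dominates every vertex of D_q, and so on cyclically, the three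
-- paths close up into a cycle of length ℓ through v.
module Submission where

open import Defs
open import Level using (Level)
open import Data.Nat using (ℕ; zero; suc; _+_; _≤_; _<_; z≤n; s≤s; z<s; _≤?_)
open import Data.Nat.Properties
  using (≤-trans; ≤-<-trans; ≰⇒>; n≢0⇒n>0; m≤n⇒m⊓n≡m; +-mono-≤; +-comm; +-assoc)
open import Data.Fin using (Fin; zero; suc; inject₁; fromℕ; fromℕ<; punchOut; _≟_)
open import Data.Fin.Properties using (injective⇒≤; punchOut-injective)
open import Data.List using (List; []; _∷_; [_]; _++_; length; lookup; take; drop; tabulate)
open import Data.List.Properties using (length-++; length-take; take-all; ++-assoc)
open import Data.List.Membership.Propositional using (_∈_)
open import Data.List.Membership.Propositional.Properties
  using (∈-lookup; ∈-tabulate⁺; ∈-++⁺ˡ; ∈-++⁺ʳ; ∈-++⁻)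
open import Data.List.Relation.Unary.Any using (here; there; index)
open import Data.List.Relation.Unary.Any.Properties using (lookup-index)
open import Data.List.Relation.Unary.All as All using (All; []; _∷_)
import Data.List.Relation.Unary.All.Properties as Allₚ
open import Data.List.Relation.Unary.AllPairs using (_∷_)
open import Data.List.Relation.Unary.Linked using (Linked; []; [-]; _∷_)
open import Data.List.Relation.Unary.Unique.Propositional using (Unique)
import Data.List.Relation.Unary.Unique.Propositional.Properties as Uniqueₚ
open import Data.List.Relation.Binary.Disjoint.Propositional using (Disjoint)
open import Data.Product using (Σ; ∃; ∃₂; _×_; _,_; proj₁; proj₂)
open import Data.Sum using (_⊎_; inj₁; inj₂)
open import Data.Empty using (⊥-elim)
open import Relation.Nullary using (yes; no)
open import Relation.Binary using (Rel)
open import Relation.Binary.PropositionalEquality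
  using (_≡_; _≢_; refl; sym; trans; cong; cong₂; subst; module ≡-Reasoning)

private
  variable
    a ℓ : Level
    X : Set a

module Linkedₚ {R : Rel X ℓ} where

  take⁺ : ∀ n {xs} → Linked R xs → Linked R (take n xs)
  take⁺ zero          _         = []
  take⁺ (suc n)       []        = []
  take⁺ (suc zero)    {_ ∷ _} _ = [-]
  take⁺ (suc (suc n)) [-]       = [-]
  take⁺ (suc (suc n)) (Rxy ∷ l) = Rxy ∷ take⁺ (suc n) l

  drop⁺ : ∀ n {xs} → Linked R xs → Linked R (drop n xs)
  drop⁺ zero    l       = l
  drop⁺ (suc n) []      = []
  drop⁺ (suc n) [-]     = drop⁺ n []
  drop⁺ (suc n) (_ ∷ l) = drop⁺ n l

  tabulate⁺ : ∀ {n} (f : Fin (suc n) → X) →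
              (∀ i → R (f (inject₁ i)) (f (suc i))) → Linked R (tabulate f)
  tabulate⁺ {zero}  f Rf = [-]
  tabulate⁺ {suc n} f Rf = Rf zero ∷ tabulate⁺ (λ i → f (suc i)) (λ i → Rf (suc i))

  ++⁺-allToHead : ∀ {xs y ys} → Linked R xs → All (λ x → R x y) xs →
                  Linked R (y ∷ ys) → Linked R (xs ++ y ∷ ys)
  ++⁺-allToHead []          []         l = l
  ++⁺-allToHead [-]         (Rxy ∷ []) l = Rxy ∷ l
  ++⁺-allToHead (Rxx′ ∷ lx) (_ ∷ Rxs)  l = Rxx′ ∷ ++⁺-allToHead lx Rxs l

  lookup⁺ : ∀ {x xs ys} → Linked R (x ∷ xs ++ ys) →
            ∀ i → R (lookup (x ∷ xs) (inject₁ i)) (lookup (x ∷ xs) (suc i))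
  lookup⁺ {xs = _ ∷ _}  (Rxy ∷ _) zero   = Rxy
  lookup⁺ {xs = _ ∷ xs} (_ ∷ l)  (suc i) = lookup⁺ {xs = xs} l i

  lookup-last⁺ : ∀ {x xs z} → Linked R (x ∷ xs ++ [ z ]) →
                 R (lookup (x ∷ xs) (fromℕ (length xs))) z
  lookup-last⁺ {xs = []}    (Rxz ∷ [-]) = Rxz
  lookup-last⁺ {xs = _ ∷ xs} (_ ∷ l)    = lookup-last⁺ {xs = xs} l

lookup-injective : ∀ {xs : List X} → Unique xs →
                   ∀ {i j} → lookup xs i ≡ lookup xs j → i ≡ j
lookup-injective (_ ∷ _)   {zero}  {zero}  _ = refl
lookup-injective (x∉ ∷ _)  {zero}  {suc j} e = ⊥-elim (All.lookup x∉ (∈-lookup j) e)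
lookup-injective (x∉ ∷ _)  {suc i} {zero}  e = ⊥-elim (All.lookup x∉ (∈-lookup i) (sym e))
lookup-injective (_ ∷ u)   {suc i} {suc j} e = cong suc (lookup-injective u e)

length-take-≤ : ∀ {n} {xs : List X} → n ≤ length xs → length (take n xs) ≡ n
length-take-≤ {n = n} {xs} n≤ = trans (length-take n xs) (m≤n⇒m⊓n≡m n≤)

length-++-++ : ∀ (xs ys zs : List X) →
               length (xs ++ ys ++ zs) ≡ length xs + (length ys + length zs)
length-++-++ xs ys zs = trans (length-++ xs) (cong (length xs +_) (length-++ ys))

window : ∀ {v : X} {xs} n → v ∈ xs → 0 < n → n ≤ length xs →
         ∃ λ s → v ∈ take n (drop s xs) × length (take n (drop s xs)) ≡ n
window zero    _              () _
window {xs = xs} (suc n) (here refl) _ n≤ = 0 , here refl , length-take-≤ {xs = xs} n≤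
window {xs = x ∷ xs} n (there v∈xs) 0<n n≤ with n ≤? length xs
... | yes n≤xs = let s , v∈ , |w|≡n = window n v∈xs 0<n n≤xs in suc s , v∈ , |w|≡n
... | no  n≰xs =
  0 , subst (_ ∈_) (sym (take-all n (x ∷ xs) (≰⇒> n≰xs))) (there v∈xs) , length-take-≤ n≤

split : ∀ x {y k l} → 0 < x → k ≤ y → k < l → l ≤ x + y →
        ∃₂ λ m n → 0 < m × m ≤ x × k ≤ n × n ≤ y × m + n ≡ l
split (suc x) {y} {l = suc l} _ k≤y (s≤s k≤l) (s≤s l≤x+y) with l ≤? y
... | yes l≤y = 1 , l , z<s , s≤s z≤n , k≤l , l≤y , refl
... | no  l≰y =
  let m , n , 0<m , m≤x , k≤n , n≤y , m+n≡l = split x 0<x k≤y (≤-<-trans k≤y (≰⇒> l≰y)) l≤x+y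
  in  suc m , n , z<s , s≤s m≤x , k≤n , n≤y , cong suc m+n≡l
  where
  0<x : 0 < x
  0<x = n≢0⇒n>0 (λ { refl → l≰y l≤x+y })

split₃ : ∀ {x y z l} → 0 < x → 0 < y → 0 < z → 3 ≤ l → l ≤ x + (y + z) →
         ∃₂ λ m n → ∃ λ o →
           0 < m × m ≤ x × 0 < n × n ≤ y × 0 < o × o ≤ z × m + (n + o) ≡ l
split₃ {x} {y} 0<x 0<y 0<z 3≤l l≤ =
  let m , k , 0<m , m≤x , 2≤k , k≤y+z , m+k≡l = split x 0<x (+-mono-≤ 0<y 0<z) 3≤l l≤
      n , o , 0<n , n≤y , 0<o , o≤z , n+o≡k  = split y 0<y 0<z 2≤k k≤y+z
  in  m , n , o , 0<m , m≤x , 0<n , n≤y , 0<o , o≤z , trans (cong (m +_) n+o≡k) m+k≡l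

+-rotate : ∀ x y z → x + (y + z) ≡ y + (z + x)
+-rotate x y z = trans (+-comm x (y + z)) (+-assoc y z x)

hasLeftInverse⇒≤ : ∀ {m n} (f : Fin m → Fin n) (g : Fin n → Fin m) →
                   (∀ i → g (f i) ≡ i) → m ≤ n
hasLeftInverse⇒≤ f g gf =
  injective⇒≤ {f = f} λ {i} {j} fi≡fj → trans (sym (gf i)) (trans (cong g fi≡fj) (gf j))

contains-allFin⇒≤length : ∀ {n} {xs : List (Fin n)} → (∀ v → v ∈ xs) → n ≤ length xs
contains-allFin⇒≤length {xs = xs} ∈xs =
  hasLeftInverse⇒≤ (λ v → index (∈xs v)) (lookup xs) (λ v → sym (lookup-index (∈xs v)))

Fin2-cover : ∀ {a b : Fin 2} → a ≢ b → ∀ x → x ≡ a ⊎ x ≡ b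
Fin2-cover {zero}     {zero}     a≢b _          = ⊥-elim (a≢b refl)
Fin2-cover {zero}     {suc zero} _   zero       = inj₁ refl
Fin2-cover {zero}     {suc zero} _   (suc zero) = inj₂ refl
Fin2-cover {suc zero} {zero}     _   zero       = inj₂ refl
Fin2-cover {suc zero} {zero}     _   (suc zero) = inj₁ refl
Fin2-cover {suc zero} {suc zero} a≢b _          = ⊥-elim (a≢b refl)

Fin3-cover : ∀ {a b c : Fin 3} → a ≢ b → b ≢ c → a ≢ c → ∀ x → x ≡ a ⊎ x ≡ b ⊎ x ≡ c
Fin3-cover {a} a≢b b≢c a≢c x with a ≟ x
... | yes a≡x = inj₁ (sym a≡x)
... | no  a≢x with Fin2-cover (λ e → b≢c (punchOut-injective a≢b a≢c e)) (punchOut a≢x)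
...   | inj₁ e = inj₂ (inj₁ (punchOut-injective a≢x a≢b e))
...   | inj₂ e = inj₂ (inj₂ (punchOut-injective a≢x a≢c e))

module _ {N : ℕ} (A : ArcRel N) where

  closedPath⇒HasCycleThrough : ∀ {x xs v} → Unique (x ∷ xs) → Linked A (x ∷ xs ++ [ x ]) →
                               v ∈ x ∷ xs → HasCycleThrough A v (length (x ∷ xs))
  closedPath⇒HasCycleThrough {x} {xs} u l v∈ =
    lookup (x ∷ xs) , (lookup-injective u , Linkedₚ.lookup⁺ l , Linkedₚ.lookup-last⁺ l) ,
    index v∈ , sym (lookup-index v∈)

  module _ (part : Fin N → Fin 3) where

    InPart : Fin 3 → Fin N → Set
    InPart i w = part w ≡ i

    PathIn : Fin 3 → List (Fin N) → Set
    PathIn i xs = Unique xs × Linked A xs × All (InPart i) xs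

    PathIn-take : ∀ {i xs} n → PathIn i xs → PathIn i (take n xs)
    PathIn-take n (u , l , xs⊆i) = Uniqueₚ.take⁺ n u , Linkedₚ.take⁺ n l , Allₚ.take⁺ n xs⊆i

    PathIn-drop : ∀ {i xs} n → PathIn i xs → PathIn i (drop n xs)
    PathIn-drop n (u , l , xs⊆i) = Uniqueₚ.drop⁺ n u , Linkedₚ.drop⁺ n l , Allₚ.drop⁺ n xs⊆i

    record HamiltonianPath (i : Fin 3) : Set where
      field
        vertices : List (Fin N)
        path     : PathIn i vertices
        nonempty : 0 < length vertices
        complete : ∀ {w} → InPart i w → w ∈ vertices

    open HamiltonianPath

    hamiltonianPath : ∀ {i} → PartHamiltonian A part i → HamiltonianPath i
    hamiltonianPath (_ , _ , c , (c-injective , c-arcs , _) , c⊆i , onto-i) = record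
      { vertices = tabulate c
      ; path     = Uniqueₚ.tabulate⁺ c-injective , Linkedₚ.tabulate⁺ c c-arcs , Allₚ.tabulate⁺ c⊆i
      ; nonempty = z<s
      ; complete = λ w∈i → let j , cj≡w = onto-i _ w∈i in
                           subst (_∈ tabulate c) cj≡w (∈-tabulate⁺ {f = c} j)
      }

    hamiltonianPaths⇒3≤N : (∀ i → HamiltonianPath i) → 3 ≤ N
    hamiltonianPaths⇒3≤N H =
      hasLeftInverse⇒≤ (λ i → proj₁ (inhabitant i)) part (λ i → proj₂ (inhabitant i))
      where
      inhabitant : ∀ i → ∃ (InPart i)
      inhabitant i =
        let k = fromℕ< (nonempty (H i))
        in  lookup (vertices (H i)) k , All.lookup (proj₂ (proj₂ (path (H i)))) (∈-lookup k)

    N≤length-sum : ∀ {i j k} → (∀ x → x ≡ i ⊎ x ≡ j ⊎ x ≡ k) →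
      (Hi : HamiltonianPath i) (Hj : HamiltonianPath j) (Hk : HamiltonianPath k) →
      N ≤ length (vertices Hi) + (length (vertices Hj) + length (vertices Hk))
    N≤length-sum cover Hi Hj Hk =
      subst (N ≤_) (length-++-++ (vertices Hi) (vertices Hj) (vertices Hk))
        (contains-allFin⇒≤length in-some-part)
      where
      in-some-part : ∀ w → w ∈ vertices Hi ++ vertices Hj ++ vertices Hk
      in-some-part w with cover (part w)
      ... | inj₁ w∈i        = ∈-++⁺ˡ (complete Hi w∈i)
      ... | inj₂ (inj₁ w∈j) = ∈-++⁺ʳ (vertices Hi) (∈-++⁺ˡ (complete Hj w∈j))
      ... | inj₂ (inj₂ w∈k) = ∈-++⁺ʳ (vertices Hi) (∈-++⁺ʳ (vertices Hj) (complete Hk w∈k))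

    ↦-disjoint : ∀ {i j xs ys} → MapsTo A part i j →
                 All (InPart i) xs → All (InPart j) ys → Disjoint xs ys
    ↦-disjoint i↦j xs⊆i ys⊆j (v∈xs , v∈ys) =
      let Avv , ¬Avv = i↦j _ _ (All.lookup xs⊆i v∈xs) (All.lookup ys⊆j v∈ys) in ¬Avv Avv

    ↦-allToHead : ∀ {i j xs y} → MapsTo A part i j →
                  All (InPart i) xs → InPart j y → All (λ x → A x y) xs
    ↦-allToHead i↦j xs⊆i y∈j = All.map (λ x∈i → proj₁ (i↦j _ _ x∈i y∈j)) xs⊆i

    module _ {p q r : Fin 3}
             (p↦q : MapsTo A part p q) (q↦r : MapsTo A part q r) (r↦p : MapsTo A part r p) where

      concatPaths⇒HasCycleThrough : ∀ {W Q R v} → PathIn p W → PathIn q Q → PathIn r R →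
        v ∈ W → 0 < length Q → 0 < length R → HasCycleThrough A v (length (W ++ Q ++ R))
      concatPaths⇒HasCycleThrough {w ∷ ws} {q₀ ∷ qs} {r₀ ∷ rs}
        (uW , lW , W⊆p) (uQ , lQ , Q⊆q) (uR , lR , R⊆r) v∈W _ _ =
        closedPath⇒HasCycleThrough unique (subst (λ zs → Linked A (w ∷ zs)) reassoc closed)
          (∈-++⁺ˡ v∈W)
        where
        W∩QR : Disjoint (w ∷ ws) (q₀ ∷ qs ++ r₀ ∷ rs)
        W∩QR (u∈W , u∈QR) with ∈-++⁻ (q₀ ∷ qs) u∈QR
        ... | inj₁ u∈Q = ↦-disjoint p↦q W⊆p Q⊆q (u∈W , u∈Q)
        ... | inj₂ u∈R = ↦-disjoint r↦p R⊆r W⊆p (u∈R , u∈W)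

        unique : Unique (w ∷ ws ++ q₀ ∷ qs ++ r₀ ∷ rs)
        unique = Uniqueₚ.++⁺ uW (Uniqueₚ.++⁺ uQ uR (↦-disjoint q↦r Q⊆q R⊆r)) W∩QR

        closed : Linked A ((w ∷ ws) ++ (q₀ ∷ qs) ++ (r₀ ∷ rs) ++ [ w ])
        closed =
          Linkedₚ.++⁺-allToHead lW (↦-allToHead p↦q W⊆p (All.head Q⊆q))
            (Linkedₚ.++⁺-allToHead lQ (↦-allToHead q↦r Q⊆q (All.head R⊆r))
              (Linkedₚ.++⁺-allToHead lR (↦-allToHead r↦p R⊆r (All.head W⊆p)) [-]))

        reassoc : ws ++ q₀ ∷ qs ++ r₀ ∷ rs ++ [ w ] ≡ (ws ++ q₀ ∷ qs ++ r₀ ∷ rs) ++ [ w ]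
        reassoc = sym (trans (++-assoc ws _ [ w ])
                             (cong (λ zs → ws ++ q₀ ∷ zs) (++-assoc qs _ [ w ])))

      hasCycleThrough : (Hp : HamiltonianPath p) (Hq : HamiltonianPath q) (Hr : HamiltonianPath r) →
        ∀ {v l} → InPart p v → 3 ≤ l →
        l ≤ length (vertices Hp) + (length (vertices Hq) + length (vertices Hr)) →
        HasCycleThrough A v l
      hasCycleThrough Hp Hq Hr {v} {l} v∈p 3≤l l≤
        with a , b , c , 0<a , a≤ , 0<b , b≤ , 0<c , c≤ , a+b+c≡l
               ← split₃ (nonempty Hp) (nonempty Hq) (nonempty Hr) 3≤l l≤
        with s , v∈W , |W|≡a ← window a (complete Hp v∈p) 0<a a≤ =
        subst (HasCycleThrough A v) |WQR|≡l
          (concatPaths⇒HasCycleThrough (PathIn-take a (PathIn-drop s (path Hp)))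
            (PathIn-take b (path Hq)) (PathIn-take c (path Hr)) v∈W
            (subst (0 <_) (sym |Q|≡b) 0<b) (subst (0 <_) (sym |R|≡c) 0<c))
        where
        W = take a (drop s (vertices Hp))
        Q = take b (vertices Hq)
        R = take c (vertices Hr)

        |Q|≡b : length Q ≡ b
        |Q|≡b = length-take-≤ b≤

        |R|≡c : length R ≡ c
        |R|≡c = length-take-≤ c≤

        |WQR|≡l : length (W ++ Q ++ R) ≡ l
        |WQR|≡l = begin
          length (W ++ Q ++ R)                   ≡⟨ length-++-++ W Q R ⟩
          length W + (length Q + length R)       ≡⟨ cong₂ _+_ |W|≡a (cong₂ _+_ |Q|≡b |R|≡c) ⟩
          a + (b + c)                            ≡⟨ a+b+c≡l ⟩
          l                                      ∎
          where open ≡-Reasoning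

lemma2 : (N : ℕ) (A : ArcRel N) (part : Fin N → Fin 3) →
    Loopless A →
    PartHamiltonian A part Fin.zero →
    PartHamiltonian A part (Fin.suc Fin.zero) →
    PartHamiltonian A part (Fin.suc (Fin.suc Fin.zero)) →
    GenSumCond A part →
    (Σ (Fin 3) λ i₁ → Σ (Fin 3) λ i₂ → Σ (Fin 3) λ i₃ →
    i₁ ≢ i₂ × i₂ ≢ i₃ × i₁ ≢ i₃ ×
    MapsTo A part i₁ i₂ × MapsTo A part i₂ i₃ × MapsTo A part i₃ i₁) →
    VertexPancyclic N A
lemma2 N A part _ H₀ H₁ H₂ _ (i₁ , i₂ , i₃ , i₁≢i₂ , i₂≢i₃ , i₁≢i₃ , ↦₁₂ , ↦₂₃ , ↦₃₁) =
  hamiltonianPaths⇒3≤N A part H , pancyclic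
  where
  H : ∀ i → HamiltonianPath A part i
  H zero             = hamiltonianPath A part H₀
  H (suc zero)       = hamiltonianPath A part H₁
  H (suc (suc zero)) = hamiltonianPath A part H₂

  n : Fin 3 → ℕ
  n i = length (HamiltonianPath.vertices (H i))

  cover : ∀ x → x ≡ i₁ ⊎ x ≡ i₂ ⊎ x ≡ i₃
  cover = Fin3-cover i₁≢i₂ i₂≢i₃ i₁≢i₃

  N≤₁ : N ≤ n i₁ + (n i₂ + n i₃)
  N≤₁ = N≤length-sum A part cover (H i₁) (H i₂) (H i₃)

  N≤₂ : N ≤ n i₂ + (n i₃ + n i₁)
  N≤₂ = subst (N ≤_) (+-rotate (n i₁) (n i₂) (n i₃)) N≤₁

  N≤₃ : N ≤ n i₃ + (n i₁ + n i₂)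
  N≤₃ = subst (N ≤_) (+-rotate (n i₂) (n i₃) (n i₁)) N≤₂

  pancyclic : ∀ v l → 3 ≤ l → l ≤ N → HasCycleThrough A v l
  pancyclic v l 3≤l l≤N with cover (part v)
  ... | inj₁ v∈₁ =
    hasCycleThrough A part ↦₁₂ ↦₂₃ ↦₃₁ (H i₁) (H i₂) (H i₃) v∈₁ 3≤l (≤-trans l≤N N≤₁)
  ... | inj₂ (inj₁ v∈₂) =
    hasCycleThrough A part ↦₂₃ ↦₃₁ ↦₁₂ (H i₂) (H i₃) (H i₁) v∈₂ 3≤l (≤-trans l≤N N≤₂)
  ... | inj₂ (inj₂ v∈₃) =
    hasCycleThrough A part ↦₃₁ ↦₁₂ ↦₂₃ (H i₃) (H i₁) (H i₂) v∈₃ 3≤l (≤-trans l≤N N≤₃)
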